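{- Let $S_n=\sum_{k=0}^n\binom{n}{k}^2\binom{2k}{k}(2k+1)$ for $n\geq 0$. Then $\{S_n\}_{n\geq 0}$ is ratio log-concave, i.e. the sequence $\{S_n/S_{n-1}\}_{n\geq 1}$ is log-concave: writing $s_n=S_n/S_{n-1}$, one has $s_n^2\geq s_{n-1}s_{n+1}$ for all $n\geq 2$.
   Context: A sequence $\{z_n\}$ of positive numbers is log-concave if $z_{n-1}z_{n+1}\leq z_n^2$ for all admissible $n$; it is called ratio log-concave if the sequence of consecutive quotients $\{z_n/z_{n-1}\}$ is log-concave. -}

module Defs where

open import Data.Nat using (ℕ; zero; suc; _+_; _*_; _≤_; _>_; NonZero; >-nonZero; z<s; s≤s; z≤n)
open import Data.Nat.Properties using (≤-trans; m≤m+n)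
open import Data.Nat.Combinatorics using (_C_)
open import Data.Integer using (+_)
open import Data.Rational using (ℚ; _/_)

sumTo : (ℕ → ℕ) → ℕ → ℕ
sumTo f zero    = f zero
sumTo f (suc n) = sumTo f n + f (suc n)

term : ℕ → ℕ → ℕ
term n k = (n C k) * (n C k) * ((2 * k) C k) * (2 * k + 1)

S : ℕ → ℕ
S n = sumTo (term n) n

-- S_n is positive (the k = 0 summand equals 1)
sumTo-≥₀ : (f : ℕ → ℕ) (n : ℕ) → f zero ≤ sumTo f n
sumTo-≥₀ f zero    = Data.Nat.Properties.≤-refl
sumTo-≥₀ f (suc n) = ≤-trans (sumTo-≥₀ f n) (m≤m+n _ _)

S-pos : (n : ℕ) → S n > 0
S-pos n = ≤-trans (s≤s z≤n) (sumTo-≥₀ (term n) n)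

S-nonZero : (n : ℕ) → NonZero (S n)
S-nonZero n = >-nonZero (S-pos n)

-- s_n = S_n / S_{n-1}, as a rational number, for n ≥ 1 (indexed by m = n - 1)
-- ratio m = S_{m+1} / S_m
ratio : ℕ → ℚ
ratio m = _/_ (+ S (suc m)) (S m) {{S-nonZero m}}

-- Creative telescoping (Zeilberger's algorithm) gives a third-order recurrence
-- c₀ S(n) + c₁ S(n+1) + c₂ S(n+2) + c₃ S(n+3) = 0 with polynomial coefficients; it is a left
-- multiple of a second-order recurrence p₀ S(n) + p₁ S(n+1) + p₂ S(n+2) = 0, which therefore
-- holds as soon as it holds at n = 0. Feeding the second-order recurrence into an induction
-- pins S(n+1)/S(n) between two rational functions of n (both tending to 9) for n ≥ 8. Eliminating
-- S(n) and S(n+3) with the recurrence and writing S(n+1), S(n+2) in terms of the two slacks of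
-- these bounds turns S(n+2)³ S(n) - S(n+1)³ S(n+3) into a polynomial with nonnegative
-- coefficients; the cases n < 7 are evaluated.

module Submission where

open import Defs
open import Data.Bool using (Bool; true; false; T; _∧_)
open import Data.Bool.Properties using (T-∧)
open import Data.Fin using (Fin; zero; suc)
open import Data.List using (List; []; _∷_)
open import Data.Nat as ℕ using (ℕ; zero; suc; NonZero; z≤n; s≤s; z<s)
open import Data.Nat.Combinatorics using (_C_; nCk+nC[k+1]≡[n+1]C[k+1]; nC1≡n; k>n⇒nCk≡0)
import Data.Nat.Properties as ℕ
import Data.Nat.Tactic.RingSolver as ℕ-Solver
open import Data.Product using (_,_)
open import Data.Vec using (Vec; []; _∷_; lookup)
open import Data.Vec.Relation.Unary.All using (All; []; _∷_)
open import Function.Bundles using (Equivalence)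
open import Relation.Nullary.Decidable using (⌊_⌋; toWitness)
open import Relation.Binary.PropositionalEquality
  using (_≡_; refl; sym; trans; cong; cong₂; subst; subst₂; module ≡-Reasoning)
open ≡-Reasoning

-- Arithmetic is opened inside anonymous modules only, so that _*_ and _≤_ in the
-- statement at the end of the file refer to ℚ.
module _ where
  open import Data.Nat using (_+_; _*_)

  [k+1]*[m+1]C[k+1]≡[m+1]*mCk : ∀ m k → suc k * (suc m C suc k) ≡ suc m * (m C k)
  [k+1]*[m+1]C[k+1]≡[m+1]*mCk zero    zero    = refl
  [k+1]*[m+1]C[k+1]≡[m+1]*mCk zero    (suc k) = ℕ.*-zeroʳ (suc (suc k))
  [k+1]*[m+1]C[k+1]≡[m+1]*mCk (suc m) zero    = trans (cong (1 *_) (nC1≡n (suc (suc m)))) (ℕ.*-comm 1 (suc (suc m)))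
  [k+1]*[m+1]C[k+1]≡[m+1]*mCk (suc m) (suc j) = begin
    suc (suc j) * (suc (suc m) C suc (suc j))
      ≡⟨ cong (suc (suc j) *_) (nCk+nC[k+1]≡[n+1]C[k+1] (suc m) (suc j)) ⟨
    suc (suc j) * (suc m C suc j + suc m C suc (suc j))
      ≡⟨ lemma (suc m C suc j) (suc m C suc (suc j)) j ⟩
    (suc j * (suc m C suc j) + suc m C suc j) + suc (suc j) * (suc m C suc (suc j))
      ≡⟨ cong₂ (λ u v → (u + suc m C suc j) + v)
               ([k+1]*[m+1]C[k+1]≡[m+1]*mCk m j) ([k+1]*[m+1]C[k+1]≡[m+1]*mCk m (suc j)) ⟩
    (suc m * (m C j) + suc m C suc j) + suc m * (m C suc j)
      ≡⟨ lemma′ (suc m) (m C j) (suc m C suc j) (m C suc j) ⟩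
    suc m * (m C j + m C suc j) + suc m C suc j
      ≡⟨ cong (λ u → suc m * u + suc m C suc j) (nCk+nC[k+1]≡[n+1]C[k+1] m j) ⟩
    suc m * (suc m C suc j) + suc m C suc j
      ≡⟨ ℕ.+-comm (suc m * (suc m C suc j)) (suc m C suc j) ⟩
    suc (suc m) * (suc m C suc j) ∎
    where
    lemma : ∀ a b j → suc (suc j) * (a + b) ≡ (suc j * a + a) + suc (suc j) * b
    lemma = ℕ-Solver.solve-∀
    lemma′ : ∀ p a b c → (p * a + b) + p * c ≡ p * (a + c) + b
    lemma′ = ℕ-Solver.solve-∀

  [n+1]*nCk+k*[n+1]Ck≡[n+1]*[n+1]Ck : ∀ n k → suc n * (n C k) + k * (suc n C k) ≡ suc n * (suc n C k)
  [n+1]*nCk+k*[n+1]Ck≡[n+1]*[n+1]Ck n zero    = ℕ.+-identityʳ (suc n * 1)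
  [n+1]*nCk+k*[n+1]Ck≡[n+1]*[n+1]Ck n (suc j) = begin
    suc n * (n C suc j) + suc j * (suc n C suc j) ≡⟨ cong (λ x → suc n * (n C suc j) + x) ([k+1]*[m+1]C[k+1]≡[m+1]*mCk n j) ⟩
    suc n * (n C suc j) + suc n * (n C j)         ≡⟨ lemma (suc n) (n C suc j) (n C j) ⟩
    suc n * (n C j + n C suc j)                   ≡⟨ cong (suc n *_) (nCk+nC[k+1]≡[n+1]C[k+1] n j) ⟩
    suc n * (suc n C suc j)                       ∎
    where lemma : ∀ p a b → p * a + p * b ≡ p * (b + a)
          lemma = ℕ-Solver.solve-∀

  [k+1]*nC[k+1]+k*nCk≡n*nCk : ∀ n k → suc k * (n C suc k) + k * (n C k) ≡ n * (n C k)
  [k+1]*nC[k+1]+k*nCk≡n*nCk zero    zero    = refl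
  [k+1]*nC[k+1]+k*nCk≡n*nCk zero    (suc j)
    rewrite k>n⇒nCk≡0 {0} {suc (suc j)} z<s | k>n⇒nCk≡0 {0} {suc j} z<s = lemma j
    where lemma : ∀ j → suc (suc j) * 0 + suc j * 0 ≡ 0
          lemma = ℕ-Solver.solve-∀
  [k+1]*nC[k+1]+k*nCk≡n*nCk (suc n) zero    = trans (ℕ.+-identityʳ (1 * (suc n C 1))) ([k+1]*[m+1]C[k+1]≡[m+1]*mCk n 0)
  [k+1]*nC[k+1]+k*nCk≡n*nCk (suc n) (suc j) = begin
    suc (suc j) * (suc n C suc (suc j)) + suc j * (suc n C suc j)
      ≡⟨ cong₂ _+_ ([k+1]*[m+1]C[k+1]≡[m+1]*mCk n (suc j)) ([k+1]*[m+1]C[k+1]≡[m+1]*mCk n j) ⟩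
    suc n * (n C suc j) + suc n * (n C j) ≡⟨ lemma (suc n) (n C suc j) (n C j) ⟩
    suc n * (n C j + n C suc j)           ≡⟨ cong (suc n *_) (nCk+nC[k+1]≡[n+1]C[k+1] n j) ⟩
    suc n * (suc n C suc j)               ∎
    where lemma : ∀ p a b → p * a + p * b ≡ p * (b + a)
          lemma = ℕ-Solver.solve-∀

module _ where
  open import Data.Integer using (ℤ; +_; -[1+_]; 0ℤ; 1ℤ; _+_; _*_; -_; _-_; _≤_; _<_; +≤+; +<+)
  open import Data.Integer.Base using (>-nonZero; positive)
  open import Data.Integer.Properties
    using ( _≟_; pos-*; pos-+; +-comm; +-identityˡ; +-identityʳ; *-zeroˡ; *-zeroʳ; *-assoc
          ; +-mono-≤; +-mono-≤-<; *-cancelˡ-≡; *-cancelˡ-≤-pos)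
  open import Data.Integer.Tactic.RingSolver using (solve-∀)

  -- A verified normaliser: T (isZero (normalise e)) and T (hasNonNegCoeffs (normalise e)) are
  -- closed Booleans, so the certificates below are checked by evaluation, with proof argument _.

  Poly : ℕ → Set
  Poly zero    = ℤ
  Poly (suc k) = List (Poly k)

  ⟦_⟧ₚ : ∀ {k} → Poly k → Vec ℤ k → ℤ
  ⟦_⟧ₚ {zero}  c       []      = c
  ⟦_⟧ₚ {suc k} []      (x ∷ ρ) = 0ℤ
  ⟦_⟧ₚ {suc k} (a ∷ p) (x ∷ ρ) = ⟦ a ⟧ₚ ρ + x * ⟦ p ⟧ₚ (x ∷ ρ)

  0ₚ : ∀ {k} → Poly k
  0ₚ {zero}  = 0ℤ
  0ₚ {suc k} = []

  constₚ : ∀ {k} → ℤ → Poly k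
  constₚ {zero}  c = c
  constₚ {suc k} c = constₚ c ∷ []

  varₚ : ∀ {k} → Fin k → Poly k
  varₚ {suc k} zero    = 0ₚ ∷ constₚ 1ℤ ∷ []
  varₚ {suc k} (suc i) = varₚ i ∷ []

  infixl 6 _+ₚ_
  infixl 7 _*ₚ_ _·ₚ_

  _+ₚ_ : ∀ {k} → Poly k → Poly k → Poly k
  _+ₚ_ {zero}  a       b       = a + b
  _+ₚ_ {suc k} []      q       = q
  _+ₚ_ {suc k} (a ∷ p) []      = a ∷ p
  _+ₚ_ {suc k} (a ∷ p) (b ∷ q) = (a +ₚ b) ∷ (p +ₚ q)

  -ₚ_ : ∀ {k} → Poly k → Poly k
  -ₚ_ {zero}  a       = - a
  -ₚ_ {suc k} []      = []
  -ₚ_ {suc k} (a ∷ p) = (-ₚ a) ∷ (-ₚ p)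

  _*ₚ_ : ∀ {k} → Poly k → Poly k → Poly k
  _·ₚ_ : ∀ {k} → Poly k → Poly (suc k) → Poly (suc k)

  _*ₚ_ {zero}  a       b = a * b
  _*ₚ_ {suc k} []      q = []
  _*ₚ_ {suc k} (a ∷ p) q = a ·ₚ q +ₚ (0ₚ ∷ p *ₚ q)

  a ·ₚ []      = []
  a ·ₚ (b ∷ q) = a *ₚ b ∷ a ·ₚ q

  isZero : ∀ {k} → Poly k → Bool
  isZero {zero}  c       = ⌊ c ≟ 0ℤ ⌋
  isZero {suc k} []      = true
  isZero {suc k} (a ∷ p) = isZero a ∧ isZero p

  hasNonNegCoeffs : ∀ {k} → Poly k → Bool
  hasNonNegCoeffs {zero}  (+ _)    = true
  hasNonNegCoeffs {zero}  -[1+ _ ] = false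
  hasNonNegCoeffs {suc k} []       = true
  hasNonNegCoeffs {suc k} (a ∷ p)  = hasNonNegCoeffs a ∧ hasNonNegCoeffs p

  i+j*0≡i : ∀ i j → i + j * 0ℤ ≡ i
  i+j*0≡i i j = trans (cong (_+_ i) (*-zeroʳ j)) (+-identityʳ i)

  ⟦0ₚ⟧ : ∀ {k} (ρ : Vec ℤ k) → ⟦ 0ₚ ⟧ₚ ρ ≡ 0ℤ
  ⟦0ₚ⟧ []      = refl
  ⟦0ₚ⟧ (x ∷ ρ) = refl

  ⟦constₚ⟧ : ∀ {k} c (ρ : Vec ℤ k) → ⟦ constₚ c ⟧ₚ ρ ≡ c
  ⟦constₚ⟧ c []      = refl
  ⟦constₚ⟧ c (x ∷ ρ) = trans (cong (_+ x * 0ℤ) (⟦constₚ⟧ c ρ)) (i+j*0≡i c x)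

  ⟦varₚ⟧ : ∀ {k} i (ρ : Vec ℤ k) → ⟦ varₚ i ⟧ₚ ρ ≡ lookup ρ i
  ⟦varₚ⟧ zero    (x ∷ ρ) = trans (cong₂ (λ a b → a + x * (b + x * 0ℤ)) (⟦0ₚ⟧ ρ) (⟦constₚ⟧ 1ℤ ρ)) (lemma x)
    where lemma : ∀ x → 0ℤ + x * (1ℤ + x * 0ℤ) ≡ x
          lemma = solve-∀
  ⟦varₚ⟧ (suc i) (x ∷ ρ) = trans (cong (_+ x * 0ℤ) (⟦varₚ⟧ i ρ)) (i+j*0≡i (lookup ρ i) x)

  ⟦+ₚ⟧ : ∀ {k} (p q : Poly k) ρ → ⟦ p +ₚ q ⟧ₚ ρ ≡ ⟦ p ⟧ₚ ρ + ⟦ q ⟧ₚ ρ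
  ⟦+ₚ⟧ {zero}  a       b       []      = refl
  ⟦+ₚ⟧ {suc k} []      q       (x ∷ ρ) = sym (+-identityˡ (⟦ q ⟧ₚ (x ∷ ρ)))
  ⟦+ₚ⟧ {suc k} (a ∷ p) []      (x ∷ ρ) = sym (+-identityʳ (⟦ a ∷ p ⟧ₚ (x ∷ ρ)))
  ⟦+ₚ⟧ {suc k} (a ∷ p) (b ∷ q) (x ∷ ρ) =
    trans (cong₂ (λ u v → u + x * v) (⟦+ₚ⟧ a b ρ) (⟦+ₚ⟧ p q (x ∷ ρ)))
          (lemma (⟦ a ⟧ₚ ρ) (⟦ b ⟧ₚ ρ) x (⟦ p ⟧ₚ (x ∷ ρ)) (⟦ q ⟧ₚ (x ∷ ρ)))
    where lemma : ∀ a b x p q → (a + b) + x * (p + q) ≡ (a + x * p) + (b + x * q)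
          lemma = solve-∀

  ⟦-ₚ⟧ : ∀ {k} (p : Poly k) ρ → ⟦ -ₚ p ⟧ₚ ρ ≡ - ⟦ p ⟧ₚ ρ
  ⟦-ₚ⟧ {zero}  a       []      = refl
  ⟦-ₚ⟧ {suc k} []      (x ∷ ρ) = refl
  ⟦-ₚ⟧ {suc k} (a ∷ p) (x ∷ ρ) =
    trans (cong₂ (λ u v → u + x * v) (⟦-ₚ⟧ a ρ) (⟦-ₚ⟧ p (x ∷ ρ))) (lemma (⟦ a ⟧ₚ ρ) x (⟦ p ⟧ₚ (x ∷ ρ)))
    where lemma : ∀ a x p → - a + x * - p ≡ - (a + x * p)
          lemma = solve-∀

  ⟦*ₚ⟧ : ∀ {k} (p q : Poly k) ρ → ⟦ p *ₚ q ⟧ₚ ρ ≡ ⟦ p ⟧ₚ ρ * ⟦ q ⟧ₚ ρ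
  ⟦·ₚ⟧ : ∀ {k} (a : Poly k) q x ρ → ⟦ a ·ₚ q ⟧ₚ (x ∷ ρ) ≡ ⟦ a ⟧ₚ ρ * ⟦ q ⟧ₚ (x ∷ ρ)

  ⟦*ₚ⟧ {zero}  a       b []      = refl
  ⟦*ₚ⟧ {suc k} []      q (x ∷ ρ) = sym (*-zeroˡ (⟦ q ⟧ₚ (x ∷ ρ)))
  ⟦*ₚ⟧ {suc k} (a ∷ p) q (x ∷ ρ) = begin
    ⟦ a ·ₚ q +ₚ (0ₚ ∷ p *ₚ q) ⟧ₚ (x ∷ ρ)
      ≡⟨ ⟦+ₚ⟧ (a ·ₚ q) (0ₚ ∷ p *ₚ q) (x ∷ ρ) ⟩
    ⟦ a ·ₚ q ⟧ₚ (x ∷ ρ) + (⟦ 0ₚ ⟧ₚ ρ + x * ⟦ p *ₚ q ⟧ₚ (x ∷ ρ))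
      ≡⟨ cong₂ (λ u v → u + (v + x * ⟦ p *ₚ q ⟧ₚ (x ∷ ρ))) (⟦·ₚ⟧ a q x ρ) (⟦0ₚ⟧ ρ) ⟩
    ⟦ a ⟧ₚ ρ * ⟦ q ⟧ₚ (x ∷ ρ) + (0ℤ + x * ⟦ p *ₚ q ⟧ₚ (x ∷ ρ))
      ≡⟨ cong (λ v → ⟦ a ⟧ₚ ρ * ⟦ q ⟧ₚ (x ∷ ρ) + (0ℤ + x * v)) (⟦*ₚ⟧ p q (x ∷ ρ)) ⟩
    ⟦ a ⟧ₚ ρ * ⟦ q ⟧ₚ (x ∷ ρ) + (0ℤ + x * (⟦ p ⟧ₚ (x ∷ ρ) * ⟦ q ⟧ₚ (x ∷ ρ)))
      ≡⟨ lemma (⟦ a ⟧ₚ ρ) x (⟦ p ⟧ₚ (x ∷ ρ)) (⟦ q ⟧ₚ (x ∷ ρ)) ⟩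
    (⟦ a ⟧ₚ ρ + x * ⟦ p ⟧ₚ (x ∷ ρ)) * ⟦ q ⟧ₚ (x ∷ ρ) ∎
    where lemma : ∀ a x p q → a * q + (0ℤ + x * (p * q)) ≡ (a + x * p) * q
          lemma = solve-∀

  ⟦·ₚ⟧ a []      x ρ = sym (*-zeroʳ (⟦ a ⟧ₚ ρ))
  ⟦·ₚ⟧ a (b ∷ q) x ρ =
    trans (cong₂ (λ u v → u + x * v) (⟦*ₚ⟧ a b ρ) (⟦·ₚ⟧ a q x ρ))
          (lemma (⟦ a ⟧ₚ ρ) (⟦ b ⟧ₚ ρ) x (⟦ q ⟧ₚ (x ∷ ρ)))
    where lemma : ∀ a b x q → a * b + x * (a * q) ≡ a * (b + x * q)
          lemma = solve-∀

  isZero-sound : ∀ {k} (p : Poly k) ρ → T (isZero p) → ⟦ p ⟧ₚ ρ ≡ 0ℤ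
  isZero-sound {zero}  c       []      z = toWitness z
  isZero-sound {suc k} []      (x ∷ ρ) z = refl
  isZero-sound {suc k} (a ∷ p) (x ∷ ρ) z with za , zp ← Equivalence.to T-∧ z =
    trans (cong₂ (λ u v → u + x * v) (isZero-sound a ρ za) (isZero-sound p (x ∷ ρ) zp)) (i+j*0≡i 0ℤ x)

  0≤i⇒0≤j⇒0≤i*j : ∀ {i j} → 0ℤ ≤ i → 0ℤ ≤ j → 0ℤ ≤ i * j
  0≤i⇒0≤j⇒0≤i*j {+ m} {+ n} _ _ = subst (0ℤ ≤_) (pos-* m n) (+≤+ z≤n)

  hasNonNegCoeffs-sound : ∀ {k} (p : Poly k) ρ → All (0ℤ ≤_) ρ → T (hasNonNegCoeffs p) → 0ℤ ≤ ⟦ p ⟧ₚ ρ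
  hasNonNegCoeffs-sound {zero}  (+ n)   []      _           _ = +≤+ z≤n
  hasNonNegCoeffs-sound {suc k} []      (x ∷ ρ) _           _ = +≤+ z≤n
  hasNonNegCoeffs-sound {suc k} (a ∷ p) (x ∷ ρ) (x≥0 ∷ ρ≥0) h with ha , hp ← Equivalence.to T-∧ h =
    +-mono-≤ (hasNonNegCoeffs-sound a ρ ρ≥0 ha)
             (0≤i⇒0≤j⇒0≤i*j x≥0 (hasNonNegCoeffs-sound p (x ∷ ρ) (x≥0 ∷ ρ≥0) hp))

  infixl 6 _⊕_ _⊖_
  infixl 7 _⊗_
  infix  8 ⊝_

  data Expr (k : ℕ) : Set where
    var         : Fin k → Expr k
    con         : ℤ → Expr k
    _⊕_ _⊗_ _⊖_ : Expr k → Expr k → Expr k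
    ⊝_          : Expr k → Expr k

  ⟦_⟧ : ∀ {k} → Expr k → Vec ℤ k → ℤ
  ⟦ var i ⟧ ρ = lookup ρ i
  ⟦ con c ⟧ ρ = c
  ⟦ a ⊕ b ⟧ ρ = ⟦ a ⟧ ρ + ⟦ b ⟧ ρ
  ⟦ a ⊗ b ⟧ ρ = ⟦ a ⟧ ρ * ⟦ b ⟧ ρ
  ⟦ a ⊖ b ⟧ ρ = ⟦ a ⟧ ρ - ⟦ b ⟧ ρ
  ⟦ ⊝ a ⟧   ρ = - ⟦ a ⟧ ρ

  normalise : ∀ {k} → Expr k → Poly k
  normalise (var i) = varₚ i
  normalise (con c) = constₚ c
  normalise (a ⊕ b) = normalise a +ₚ normalise b
  normalise (a ⊗ b) = normalise a *ₚ normalise b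
  normalise (a ⊖ b) = normalise a +ₚ -ₚ normalise b
  normalise (⊝ a)   = -ₚ normalise a

  ⟦normalise⟧ : ∀ {k} (e : Expr k) ρ → ⟦ normalise e ⟧ₚ ρ ≡ ⟦ e ⟧ ρ
  ⟦normalise⟧ (var i) ρ = ⟦varₚ⟧ i ρ
  ⟦normalise⟧ (con c) ρ = ⟦constₚ⟧ c ρ
  ⟦normalise⟧ (a ⊕ b) ρ = trans (⟦+ₚ⟧ (normalise a) (normalise b) ρ) (cong₂ _+_ (⟦normalise⟧ a ρ) (⟦normalise⟧ b ρ))
  ⟦normalise⟧ (a ⊗ b) ρ = trans (⟦*ₚ⟧ (normalise a) (normalise b) ρ) (cong₂ _*_ (⟦normalise⟧ a ρ) (⟦normalise⟧ b ρ))
  ⟦normalise⟧ (a ⊖ b) ρ = trans (⟦+ₚ⟧ (normalise a) (-ₚ normalise b) ρ)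
    (cong₂ _+_ (⟦normalise⟧ a ρ) (trans (⟦-ₚ⟧ (normalise b) ρ) (cong -_ (⟦normalise⟧ b ρ))))
  ⟦normalise⟧ (⊝ a)   ρ = trans (⟦-ₚ⟧ (normalise a) ρ) (cong -_ (⟦normalise⟧ a ρ))

  ≡-by-normalising : ∀ {k} (a b : Expr k) → T (isZero (normalise (a ⊖ b))) → ∀ ρ → ⟦ a ⟧ ρ ≡ ⟦ b ⟧ ρ
  ≡-by-normalising a b z ρ = i-j≡0⇒i≡j (trans (sym (⟦normalise⟧ (a ⊖ b) ρ)) (isZero-sound _ ρ z))
    where i-j≡0⇒i≡j : ∀ {i j} → i - j ≡ 0ℤ → i ≡ j
          i-j≡0⇒i≡j {i} {j} d = trans (lemma i j) (trans (cong (_+ j) d) (+-identityˡ j))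
            where lemma : ∀ i j → i ≡ (i - j) + j
                  lemma = solve-∀

  0≤-by-normalising : ∀ {k} (e : Expr k) → T (hasNonNegCoeffs (normalise e)) →
                      ∀ ρ → All (0ℤ ≤_) ρ → 0ℤ ≤ ⟦ e ⟧ ρ
  0≤-by-normalising e h ρ ρ≥0 = subst (0ℤ ≤_) (⟦normalise⟧ e ρ) (hasNonNegCoeffs-sound (normalise e) ρ ρ≥0 h)

  0<-by-normalising : ∀ {k} (e : Expr k) → T (hasNonNegCoeffs (normalise (e ⊖ con 1ℤ))) →
                      ∀ ρ → All (0ℤ ≤_) ρ → 0ℤ < ⟦ e ⟧ ρ
  0<-by-normalising e h ρ ρ≥0 =
    subst (0ℤ <_) (lemma (⟦ e ⟧ ρ)) (+-mono-≤-< (0≤-by-normalising (e ⊖ con 1ℤ) h ρ ρ≥0) (+<+ (s≤s z≤n)))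
    where lemma : ∀ x → x - 1ℤ + 1ℤ ≡ x
          lemma = solve-∀

  0≤-by-certificate : ∀ p r {x q c} → 0ℤ < p → q ≡ 0ℤ → p * x - r * q ≡ c → 0ℤ ≤ c → 0ℤ ≤ x
  0≤-by-certificate p r {x} p>0 refl eq c≥0 =
    *-cancelˡ-≤-pos 0ℤ x p {{positive p>0}}
      (subst (_≤ p * x) (sym (*-zeroʳ p)) (subst (0ℤ ≤_) (trans (sym eq) (lemma p x r)) c≥0))
    where lemma : ∀ p x r → p * x - r * 0ℤ ≡ p * x
          lemma = solve-∀

  poly : ∀ {k} → List ℕ → Expr k → Expr k
  poly []       x = con 0ℤ
  poly (c ∷ cs) x = con (+ c) ⊕ x ⊗ poly cs x

  infixl 6 _+̂_
  _+̂_ : ∀ {k} → ℕ → Expr k → Expr k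
  i +̂ x = con (+ i) ⊕ x

  infix 9 _² _³ _⁴
  _² _³ _⁴ : ∀ {k} → Expr k → Expr k
  x ² = x ⊗ x
  x ³ = x ⊗ x ⊗ x
  x ⁴ = x ⊗ x ⊗ x ⊗ x

  v₀ : ∀ {k} → Expr (1 ℕ.+ k)
  v₀ = var zero
  v₁ : ∀ {k} → Expr (2 ℕ.+ k)
  v₁ = var (suc zero)
  v₂ : ∀ {k} → Expr (3 ℕ.+ k)
  v₂ = var (suc (suc zero))
  v₃ : ∀ {k} → Expr (4 ℕ.+ k)
  v₃ = var (suc (suc (suc zero)))
  v₄ : ∀ {k} → Expr (5 ℕ.+ k)
  v₄ = var (suc (suc (suc (suc zero))))

  _⟨_⟩ : (Expr 1 → Expr 1) → ℤ → ℤ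
  f ⟨ x ⟩ = ⟦ f v₀ ⟧ (x ∷ [])

  i*k-j*k≡[i-j]*k : ∀ i j k → i * k - j * k ≡ (i - j) * k
  i*k-j*k≡[i-j]*k = solve-∀

  m+n≡o⇒+m≡+o-+n : ∀ {m n o} → m ℕ.+ n ≡ o → + m ≡ + o - + n
  m+n≡o⇒+m≡+o-+n {m} {n} refl = trans (lemma (+ m) (+ n)) (cong (_- + n) (sym (pos-+ m n)))
    where lemma : ∀ i j → i ≡ i + j - j
          lemma = solve-∀

  [n+1]*nCk≡[n+1-k]*[n+1]Ck : ∀ n k → + suc n * + (n C k) ≡ (+ suc n - + k) * + (suc n C k)
  [n+1]*nCk≡[n+1-k]*[n+1]Ck n k = begin
    + suc n * + (n C k)                               ≡⟨ pos-* (suc n) (n C k) ⟨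
    + (suc n ℕ.* (n C k))                             ≡⟨ m+n≡o⇒+m≡+o-+n ([n+1]*nCk+k*[n+1]Ck≡[n+1]*[n+1]Ck n k) ⟩
    + (suc n ℕ.* (suc n C k)) - + (k ℕ.* (suc n C k)) ≡⟨ cong₂ _-_ (pos-* (suc n) (suc n C k)) (pos-* k (suc n C k)) ⟩
    + suc n * + (suc n C k) - + k * + (suc n C k)     ≡⟨ i*k-j*k≡[i-j]*k (+ suc n) (+ k) (+ (suc n C k)) ⟩
    (+ suc n - + k) * + (suc n C k)                   ∎

  [k+1]*nC[k+1]≡[n-k]*nCk : ∀ n k → + suc k * + (n C suc k) ≡ (+ n - + k) * + (n C k)
  [k+1]*nC[k+1]≡[n-k]*nCk n k = begin
    + suc k * + (n C suc k)                   ≡⟨ pos-* (suc k) (n C suc k) ⟨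
    + (suc k ℕ.* (n C suc k))                 ≡⟨ m+n≡o⇒+m≡+o-+n ([k+1]*nC[k+1]+k*nCk≡n*nCk n k) ⟩
    + (n ℕ.* (n C k)) - + (k ℕ.* (n C k))     ≡⟨ cong₂ _-_ (pos-* n (n C k)) (pos-* k (n C k)) ⟩
    + n * + (n C k) - + k * + (n C k)         ≡⟨ i*k-j*k≡[i-j]*k (+ n) (+ k) (+ (n C k)) ⟩
    (+ n - + k) * + (n C k)                   ∎

  [k+1]*[2k+2]C[k+1]≡2[2k+1]*[2k]Ck : ∀ k →
    + suc k * + ((2 ℕ.* suc k) C suc k) ≡ + 2 * (+ 2 * + k + + 1) * + ((2 ℕ.* k) C k)
  [k+1]*[2k+2]C[k+1]≡2[2k+1]*[2k]Ck k = *-cancelˡ-≡ (+ suc k) _ _ (begin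
    (+ 1 + κ) * ((+ 1 + κ) * U)             ≡⟨ cong ((+ 1 + κ) *_) step₁ ⟩
    (+ 1 + κ) * ((+ 2 + κ) * Z)             ≡⟨ cong ((+ 1 + κ) *_) step₂ ⟨
    (+ 1 + κ) * ((+ 2 * κ + + 2) * Y)       ≡⟨ lemma κ Y ⟩
    + 2 * (+ 1 + κ) * ((+ 1 + κ) * Y)       ≡⟨ cong (+ 2 * (+ 1 + κ) *_) step₃ ⟨
    + 2 * (+ 1 + κ) * ((+ 2 * κ + + 1) * X) ≡⟨ lemma′ κ X ⟩
    (+ 1 + κ) * (+ 2 * (+ 2 * κ + + 1) * X) ∎)
    where
    a : ℕ
    a = 2 ℕ.* k
    κ X Y Z U : ℤ
    κ = + k
    X = + (a C k)
    Y = + (suc a C k)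
    Z = + (suc (suc a) C k)
    U = + ((2 ℕ.* suc k) C suc k)
    [2k+i]-k≡i+k : ∀ i → + i + + a - κ ≡ + i + κ
    [2k+i]-k≡i+k i = trans (cong (λ α → + i + α - κ) (pos-* 2 k)) (lemma″ (+ i) κ)
      where lemma″ : ∀ ι κ → ι + + 2 * κ - κ ≡ ι + κ
            lemma″ = solve-∀
    [2k+i]≡2k+i : ∀ i → + i + + a ≡ + 2 * κ + + i
    [2k+i]≡2k+i i = trans (cong (_+_ (+ i)) (pos-* 2 k)) (+-comm (+ i) (+ 2 * κ))
    step₁ : (+ 1 + κ) * U ≡ (+ 2 + κ) * Z
    step₁ = begin
      (+ 1 + κ) * U                       ≡⟨ cong (λ m → + suc k * + (m C suc k)) (ℕ.*-suc 2 k) ⟩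
      + suc k * + (suc (suc a) C suc k)   ≡⟨ [k+1]*nC[k+1]≡[n-k]*nCk (suc (suc a)) k ⟩
      (+ 2 + + a - κ) * Z                 ≡⟨ cong (_* Z) ([2k+i]-k≡i+k 2) ⟩
      (+ 2 + κ) * Z                       ∎
    step₂ : (+ 2 * κ + + 2) * Y ≡ (+ 2 + κ) * Z
    step₂ = begin
      (+ 2 * κ + + 2) * Y ≡⟨ cong (_* Y) ([2k+i]≡2k+i 2) ⟨
      (+ 2 + + a) * Y     ≡⟨ [n+1]*nCk≡[n+1-k]*[n+1]Ck (suc a) k ⟩
      (+ 2 + + a - κ) * Z ≡⟨ cong (_* Z) ([2k+i]-k≡i+k 2) ⟩
      (+ 2 + κ) * Z       ∎
    step₃ : (+ 2 * κ + + 1) * X ≡ (+ 1 + κ) * Y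
    step₃ = begin
      (+ 2 * κ + + 1) * X ≡⟨ cong (_* X) ([2k+i]≡2k+i 1) ⟨
      (+ 1 + + a) * X     ≡⟨ [n+1]*nCk≡[n+1-k]*[n+1]Ck a k ⟩
      (+ 1 + + a - κ) * Y ≡⟨ cong (_* Y) ([2k+i]-k≡i+k 1) ⟩
      (+ 1 + κ) * Y       ∎
    lemma : ∀ κ y → (+ 1 + κ) * ((+ 2 * κ + + 2) * y) ≡ + 2 * (+ 1 + κ) * ((+ 1 + κ) * y)
    lemma = solve-∀
    lemma′ : ∀ κ x → + 2 * (+ 1 + κ) * ((+ 2 * κ + + 1) * x) ≡ (+ 1 + κ) * (+ 2 * (+ 2 * κ + + 1) * x)
    lemma′ = solve-∀

  -- Zeilberger's algorithm applied to the summand F below yields the operator L₃ and the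
  -- certificate G with L₃ (F · k) n = G n (k + 1) - G n k.
  c₀ c₁ c₂ c₃ : ∀ {k} → Expr k → Expr k
  c₀ n = ⊝ poly (324 ∷ 1188 ∷ 1737 ∷ 1296 ∷ 522 ∷ 108 ∷ 9 ∷ []) n
  c₁ n =   poly (3132 ∷ 7884 ∷ 8343 ∷ 4748 ∷ 1530 ∷ 264 ∷ 19 ∷ []) n
  c₂ n = ⊝ poly (3132 ∷ 7452 ∷ 7335 ∷ 3824 ∷ 1114 ∷ 172 ∷ 11 ∷ []) n
  c₃ n =   poly (324 ∷ 756 ∷ 729 ∷ 372 ∷ 106 ∷ 16 ∷ 1 ∷ []) n

  g : ∀ {k} → Expr k → Expr k → Expr k
  g {k} n t = (1 +̂ t) ⊗ t ⊗ (3 +̂ n ⊖ t) ⊗ N (1 +̂ t)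
    where
    N : Expr k → Expr k
    N s = ⊝ poly (240 ∷ 236 ∷ 76 ∷ 8 ∷ []) n
          ⊕ s ⊗ (poly (168 ∷ 111 ∷ 18 ∷ []) n ⊕ s ⊗ (⊝ poly (39 ∷ 13 ∷ []) n ⊕ s ⊗ con (+ 3)))

  L₃ : (ℕ → ℤ) → ℕ → ℤ
  L₃ u n = c₀ ⟨ + n ⟩ * u n + c₁ ⟨ + n ⟩ * u (1 ℕ.+ n)
         + c₂ ⟨ + n ⟩ * u (2 ℕ.+ n) + c₃ ⟨ + n ⟩ * u (3 ℕ.+ n)

  L₃-cong : ∀ {u v} n → u n ≡ v n → u (1 ℕ.+ n) ≡ v (1 ℕ.+ n) →
            u (2 ℕ.+ n) ≡ v (2 ℕ.+ n) → u (3 ℕ.+ n) ≡ v (3 ℕ.+ n) → L₃ u n ≡ L₃ v n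
  L₃-cong n e₀ e₁ e₂ e₃ = cong₂ _+_ (cong₂ _+_ (cong₂ _+_ (cong (c₀ ⟨ + n ⟩ *_) e₀) (cong (c₁ ⟨ + n ⟩ *_) e₁))
                                               (cong (c₂ ⟨ + n ⟩ *_) e₂))
                                    (cong (c₃ ⟨ + n ⟩ *_) e₃)

  F : ℕ → ℕ → ℤ
  F n k = + term n k

  n̂ t̂ : Expr 2
  n̂ = v₀
  t̂ = v₁

  G : ℕ → ℕ → ℤ
  G n zero    = 0ℤ
  G n (suc t) = ⟦ g n̂ t̂ ⟧ (+ n ∷ + t ∷ []) * + ((3 ℕ.+ n) C t) * + ((3 ℕ.+ n) C t)
                * + ((2 ℕ.* suc t) C suc t) * (+ 2 * + t + + 3)

  F-suc : ∀ m t → F m (suc t) ≡ + (m C suc t) * + (m C suc t) * + ((2 ℕ.* suc t) C suc t) * (+ 2 * + t + + 3)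
  F-suc m t = begin
    + (b ℕ.* b ℕ.* w ℕ.* (2 ℕ.* suc t ℕ.+ 1))   ≡⟨ pos-* (b ℕ.* b ℕ.* w) (2 ℕ.* suc t ℕ.+ 1) ⟩
    + (b ℕ.* b ℕ.* w) * + (2 ℕ.* suc t ℕ.+ 1)   ≡⟨ cong₂ _*_ (trans (pos-* (b ℕ.* b) w) (cong (_* + w) (pos-* b b)))
                                                             (trans (pos-+ (2 ℕ.* suc t) 1) (cong (_+ + 1) (pos-* 2 (suc t)))) ⟩
    + b * + b * + w * (+ 2 * (+ 1 + + t) + + 1) ≡⟨ lemma (+ b * + b * + w) (+ t) ⟩
    + b * + b * + w * (+ 2 * + t + + 3)         ∎
    where
    b w : ℕ
    b = m C suc t
    w = (2 ℕ.* suc t) C suc t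
    lemma : ∀ x t → x * (+ 2 * (+ 1 + t) + + 1) ≡ x * (+ 2 * t + + 3)
    lemma = solve-∀

  -- (t+1)(n+j+1)⋯(n+3) C(n+j, t+1) = Qⱼ C(n+3, t), see scaled-bⱼ below.
  Q₀ Q₁ Q₂ Q₃ Π₁ Π₂ Π₃ : Expr 2
  Q₃ = 3 +̂ n̂ ⊖ t̂
  Q₂ = Q₃ ⊗ (2 +̂ n̂ ⊖ t̂)
  Q₁ = Q₂ ⊗ (1 +̂ n̂ ⊖ t̂)
  Q₀ = Q₁ ⊗ (n̂ ⊖ t̂)
  Π₁ = 1 +̂ n̂
  Π₂ = Π₁ ⊗ (2 +̂ n̂)
  Π₃ = Π₂ ⊗ (3 +̂ n̂)

  telescoping-lhs telescoping-rhs denominator : Expr 2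
  telescoping-lhs = (2 +̂ t̂) ⊗ (c₀ n̂ ⊗ Q₀ ² ⊕ c₁ n̂ ⊗ Q₁ ² ⊗ Π₁ ² ⊕ c₂ n̂ ⊗ Q₂ ² ⊗ Π₂ ² ⊕ c₃ n̂ ⊗ Q₃ ² ⊗ Π₃ ²)
  telescoping-rhs = Π₃ ² ⊗ (con (+ 2) ⊗ Q₃ ² ⊗ g n̂ (1 +̂ t̂) ⊗ (con (+ 2) ⊗ t̂ ⊕ con (+ 5))
                            ⊖ (1 +̂ t̂) ² ⊗ (2 +̂ t̂) ⊗ g n̂ t̂)
  denominator     = (1 +̂ t̂) ² ⊗ Π₃ ² ⊗ (2 +̂ t̂)

  telescoping-identity : ∀ ρ → ⟦ telescoping-lhs ⟧ ρ ≡ ⟦ telescoping-rhs ⟧ ρ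
  telescoping-identity = ≡-by-normalising telescoping-lhs telescoping-rhs _

  -- g n 0 = 0, so the right-hand side evaluates to 0.
  telescoping-step-zero : ∀ n → L₃ (λ m → F m 0) n ≡ G n 1 - G n 0
  telescoping-step-zero n =
    ≡-by-normalising (c₀ n̂ ⊗ con (+ 1) ⊕ c₁ n̂ ⊗ con (+ 1) ⊕ c₂ n̂ ⊗ con (+ 1) ⊕ c₃ n̂ ⊗ con (+ 1)) (con 0ℤ) _
                     (+ n ∷ + 0 ∷ [])

  module _ (n t : ℕ) where
    private
      ρ : Vec ℤ 2
      ρ = + n ∷ + t ∷ []

      ⟪_⟫ : Expr 2 → ℤ
      ⟪ e ⟫ = ⟦ e ⟧ ρ

      b : ℕ → ℤ
      b j = + ((j ℕ.+ n) C suc t)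

      c w w′ s₃ τ₁ τ₂ : ℤ
      c  = + ((3 ℕ.+ n) C t)
      w  = + ((2 ℕ.* suc t) C suc t)
      w′ = + ((2 ℕ.* suc (suc t)) C suc (suc t))
      s₃ = + 2 * + t + + 3
      τ₁ = ⟪ 1 +̂ t̂ ⟫
      τ₂ = ⟪ 2 +̂ t̂ ⟫

      scaled-b₃ : τ₁ * b 3 ≡ ⟪ Q₃ ⟫ * c
      scaled-b₃ = [k+1]*nC[k+1]≡[n-k]*nCk (3 ℕ.+ n) t

      scaled-b-step : ∀ j x q → x * b (suc j) ≡ q * c → x * + suc (j ℕ.+ n) * b j ≡ q * (+ (j ℕ.+ n) - + t) * c
      scaled-b-step j x q h = begin
        x * + suc (j ℕ.+ n) * b j                     ≡⟨ *-assoc x (+ suc (j ℕ.+ n)) (b j) ⟩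
        x * (+ suc (j ℕ.+ n) * b j)                   ≡⟨ cong (x *_) ([n+1]*nCk≡[n+1-k]*[n+1]Ck (j ℕ.+ n) (suc t)) ⟩
        x * ((+ suc (j ℕ.+ n) - + suc t) * b (suc j)) ≡⟨ lemma x (+ (j ℕ.+ n)) (+ t) (b (suc j)) ⟩
        (+ (j ℕ.+ n) - + t) * (x * b (suc j))         ≡⟨ cong ((+ (j ℕ.+ n) - + t) *_) h ⟩
        (+ (j ℕ.+ n) - + t) * (q * c)                 ≡⟨ lemma′ (+ (j ℕ.+ n) - + t) q c ⟩
        q * (+ (j ℕ.+ n) - + t) * c                   ∎
        where
        lemma : ∀ x a t b → x * ((+ 1 + a - (+ 1 + t)) * b) ≡ (a - t) * (x * b)
        lemma = solve-∀
        lemma′ : ∀ d q c → d * (q * c) ≡ q * d * c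
        lemma′ = solve-∀

      scaled-b₂ : τ₁ * ⟪ 3 +̂ n̂ ⟫ * b 2 ≡ ⟪ Q₂ ⟫ * c
      scaled-b₂ = scaled-b-step 2 τ₁ ⟪ Q₃ ⟫ scaled-b₃

      scaled-b₁ : τ₁ * ⟪ 3 +̂ n̂ ⟫ * ⟪ 2 +̂ n̂ ⟫ * b 1 ≡ ⟪ Q₁ ⟫ * c
      scaled-b₁ = scaled-b-step 1 (τ₁ * ⟪ 3 +̂ n̂ ⟫) ⟪ Q₂ ⟫ scaled-b₂

      scaled-b₀ : τ₁ * ⟪ 3 +̂ n̂ ⟫ * ⟪ 2 +̂ n̂ ⟫ * ⟪ 1 +̂ n̂ ⟫ * b 0 ≡ ⟪ Q₀ ⟫ * c
      scaled-b₀ = scaled-b-step 0 (τ₁ * ⟪ 3 +̂ n̂ ⟫ * ⟪ 2 +̂ n̂ ⟫) ⟪ Q₁ ⟫ scaled-b₁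

      weighted : ℤ → ℤ → ℤ → ℤ → ℤ
      weighted x₀ x₁ x₂ x₃ = c₀ ⟨ + n ⟩ * (x₀ * x₀) + c₁ ⟨ + n ⟩ * (x₁ * x₁) * ⟪ Π₁ ² ⟫
                           + c₂ ⟨ + n ⟩ * (x₂ * x₂) * ⟪ Π₂ ² ⟫ + c₃ ⟨ + n ⟩ * (x₃ * x₃) * ⟪ Π₃ ² ⟫

      weighted-cong : ∀ {x₀ x₁ x₂ x₃ y₀ y₁ y₂ y₃} → x₀ ≡ y₀ → x₁ ≡ y₁ → x₂ ≡ y₂ → x₃ ≡ y₃ →
                      weighted x₀ x₁ x₂ x₃ ≡ weighted y₀ y₁ y₂ y₃
      weighted-cong refl refl refl refl = refl

      scaled-lhs : ⟪ denominator ⟫ * L₃ (λ m → F m (suc t)) n ≡ c * c * w * s₃ * ⟪ telescoping-lhs ⟫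
      scaled-lhs = begin
        ⟪ denominator ⟫ * L₃ (λ m → F m (suc t)) n
          ≡⟨ cong (⟪ denominator ⟫ *_) (L₃-cong {λ m → F m (suc t)} {λ m → + (m C suc t) * + (m C suc t) * w * s₃} n
                    (F-suc n t) (F-suc (1 ℕ.+ n) t) (F-suc (2 ℕ.+ n) t) (F-suc (3 ℕ.+ n) t)) ⟩
        ⟪ denominator ⟫ * L₃ (λ m → + (m C suc t) * + (m C suc t) * w * s₃) n
          ≡⟨ regroup τ₁ τ₂ p₁ p₂ p₃ w s₃ (c₀ ⟨ + n ⟩) (c₁ ⟨ + n ⟩) (c₂ ⟨ + n ⟩) (c₃ ⟨ + n ⟩)
                     (b 0) (b 1) (b 2) (b 3) ⟩
        w * s₃ * (τ₂ * weighted (τ₁ * p₃ * p₂ * p₁ * b 0) (τ₁ * p₃ * p₂ * b 1) (τ₁ * p₃ * b 2) (τ₁ * b 3))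
          ≡⟨ cong (λ x → w * s₃ * (τ₂ * x)) (weighted-cong scaled-b₀ scaled-b₁ scaled-b₂ scaled-b₃) ⟩
        w * s₃ * (τ₂ * weighted (⟪ Q₀ ⟫ * c) (⟪ Q₁ ⟫ * c) (⟪ Q₂ ⟫ * c) (⟪ Q₃ ⟫ * c))
          ≡⟨ collect c w s₃ τ₂ p₁ p₂ p₃ (c₀ ⟨ + n ⟩) (c₁ ⟨ + n ⟩) (c₂ ⟨ + n ⟩) (c₃ ⟨ + n ⟩)
                     ⟪ Q₀ ⟫ ⟪ Q₁ ⟫ ⟪ Q₂ ⟫ ⟪ Q₃ ⟫ ⟩
        c * c * w * s₃ * ⟪ telescoping-lhs ⟫ ∎
        where
        p₁ p₂ p₃ : ℤ
        p₁ = ⟪ 1 +̂ n̂ ⟫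
        p₂ = ⟪ 2 +̂ n̂ ⟫
        p₃ = ⟪ 3 +̂ n̂ ⟫
        regroup : ∀ τ₁ τ₂ p₁ p₂ p₃ w s k₀ k₁ k₂ k₃ b₀ b₁ b₂ b₃ →
          τ₁ * τ₁ * ((p₁ * p₂ * p₃) * (p₁ * p₂ * p₃)) * τ₂
            * (k₀ * (b₀ * b₀ * w * s) + k₁ * (b₁ * b₁ * w * s) + k₂ * (b₂ * b₂ * w * s) + k₃ * (b₃ * b₃ * w * s))
          ≡ w * s * (τ₂ * (k₀ * ((τ₁ * p₃ * p₂ * p₁ * b₀) * (τ₁ * p₃ * p₂ * p₁ * b₀))
                         + k₁ * ((τ₁ * p₃ * p₂ * b₁) * (τ₁ * p₃ * p₂ * b₁)) * (p₁ * p₁)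
                         + k₂ * ((τ₁ * p₃ * b₂) * (τ₁ * p₃ * b₂)) * ((p₁ * p₂) * (p₁ * p₂))
                         + k₃ * ((τ₁ * b₃) * (τ₁ * b₃)) * ((p₁ * p₂ * p₃) * (p₁ * p₂ * p₃))))
        regroup = solve-∀
        collect : ∀ c w s τ₂ p₁ p₂ p₃ k₀ k₁ k₂ k₃ q₀ q₁ q₂ q₃ →
          w * s * (τ₂ * (k₀ * ((q₀ * c) * (q₀ * c)) + k₁ * ((q₁ * c) * (q₁ * c)) * (p₁ * p₁)
                        + k₂ * ((q₂ * c) * (q₂ * c)) * ((p₁ * p₂) * (p₁ * p₂))
                        + k₃ * ((q₃ * c) * (q₃ * c)) * ((p₁ * p₂ * p₃) * (p₁ * p₂ * p₃))))
          ≡ c * c * w * s * (τ₂ * (k₀ * (q₀ * q₀) + k₁ * (q₁ * q₁) * (p₁ * p₁)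
                                  + k₂ * (q₂ * q₂) * ((p₁ * p₂) * (p₁ * p₂))
                                  + k₃ * (q₃ * q₃) * ((p₁ * p₂ * p₃) * (p₁ * p₂ * p₃))))
        collect = solve-∀

      scaled-rhs : ⟪ denominator ⟫ * (G n (suc (suc t)) - G n (suc t)) ≡ c * c * w * s₃ * ⟪ telescoping-rhs ⟫
      scaled-rhs = begin
        ⟪ denominator ⟫ * (G n (suc (suc t)) - G n (suc t))
          ≡⟨ regroup τ₁ τ₂ π w w′ s₃ s₅ g₁ g₂ (b 3) c ⟩
        π * π * ((τ₁ * b 3) * (τ₁ * b 3) * (τ₂ * w′) * g₂ * s₅ - τ₁ * τ₁ * τ₂ * g₁ * (c * c * w * s₃))
          ≡⟨ cong₂ (λ x y → π * π * (x * x * y * g₂ * s₅ - τ₁ * τ₁ * τ₂ * g₁ * (c * c * w * s₃)))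
                   scaled-b₃ ([k+1]*[2k+2]C[k+1]≡2[2k+1]*[2k]Ck (suc t)) ⟩
        π * π * ((⟪ Q₃ ⟫ * c) * (⟪ Q₃ ⟫ * c) * (+ 2 * (+ 2 * + suc t + + 1) * w) * g₂ * s₅
                 - τ₁ * τ₁ * τ₂ * g₁ * (c * c * w * s₃))
          ≡⟨ collect c w π τ₁ τ₂ ⟪ Q₃ ⟫ g₁ g₂ (+ t) ⟩
        c * c * w * s₃ * ⟪ telescoping-rhs ⟫ ∎
        where
        π s₅ g₁ g₂ : ℤ
        π  = ⟪ Π₃ ⟫
        s₅ = + 2 * + suc t + + 3
        g₁ = ⟪ g n̂ t̂ ⟫
        g₂ = ⟪ g n̂ (1 +̂ t̂) ⟫
        regroup : ∀ τ₁ τ₂ π w w′ s₃ s₅ g₁ g₂ b₃ c →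
          τ₁ * τ₁ * (π * π) * τ₂ * (g₂ * b₃ * b₃ * w′ * s₅ - g₁ * c * c * w * s₃)
          ≡ π * π * ((τ₁ * b₃) * (τ₁ * b₃) * (τ₂ * w′) * g₂ * s₅ - τ₁ * τ₁ * τ₂ * g₁ * (c * c * w * s₃))
        regroup = solve-∀
        collect : ∀ c w π τ₁ τ₂ q₃ g₁ g₂ t →
          π * π * ((q₃ * c) * (q₃ * c) * (+ 2 * (+ 2 * (+ 1 + t) + + 1) * w) * g₂ * (+ 2 * (+ 1 + t) + + 3)
                   - τ₁ * τ₁ * τ₂ * g₁ * (c * c * w * (+ 2 * t + + 3)))
          ≡ c * c * w * (+ 2 * t + + 3) * (π * π * (+ 2 * (q₃ * q₃) * g₂ * (+ 2 * t + + 5) - τ₁ * τ₁ * τ₂ * g₁))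
        collect = solve-∀

    telescoping-step-suc : L₃ (λ m → F m (suc t)) n ≡ G n (suc (suc t)) - G n (suc t)
    telescoping-step-suc = *-cancelˡ-≡ ⟪ denominator ⟫ _ _ {{>-nonZero denominator>0}} (begin
      ⟪ denominator ⟫ * L₃ (λ m → F m (suc t)) n          ≡⟨ scaled-lhs ⟩
      c * c * w * s₃ * ⟪ telescoping-lhs ⟫                ≡⟨ cong (c * c * w * s₃ *_) (telescoping-identity ρ) ⟩
      c * c * w * s₃ * ⟪ telescoping-rhs ⟫                ≡⟨ scaled-rhs ⟨
      ⟪ denominator ⟫ * (G n (suc (suc t)) - G n (suc t)) ∎)
      where
      denominator>0 : 0ℤ < ⟪ denominator ⟫
      denominator>0 = 0<-by-normalising denominator _ ρ (+≤+ z≤n ∷ +≤+ z≤n ∷ [])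

  telescoping-step : ∀ n k → L₃ (λ m → F m k) n ≡ G n (suc k) - G n k
  telescoping-step n zero    = telescoping-step-zero n
  telescoping-step n (suc t) = telescoping-step-suc n t

  ∑ : (ℕ → ℤ) → ℕ → ℤ
  ∑ f zero    = f zero
  ∑ f (suc N) = ∑ f N + f (suc N)

  ∑-cong : ∀ {f g} N → (∀ k → f k ≡ g k) → ∑ f N ≡ ∑ g N
  ∑-cong zero    f≡g = f≡g zero
  ∑-cong (suc N) f≡g = cong₂ _+_ (∑-cong N f≡g) (f≡g (suc N))

  ∑-telescope : ∀ (h : ℕ → ℤ) N → ∑ (λ k → h (suc k) - h k) N ≡ h (suc N) - h 0
  ∑-telescope h zero    = refl
  ∑-telescope h (suc N) = trans (cong (_+ (h (suc (suc N)) - h (suc N))) (∑-telescope h N))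
                                (lemma (h (suc (suc N))) (h (suc N)) (h 0))
    where lemma : ∀ a b c → b - c + (a - b) ≡ a - c
          lemma = solve-∀

  ∑-L₃ : ∀ (f : ℕ → ℕ → ℤ) n N → ∑ (λ k → L₃ (λ m → f m k) n) N ≡ L₃ (λ m → ∑ (f m) N) n
  ∑-L₃ f n zero    = refl
  ∑-L₃ f n (suc N) = trans (cong (_+ L₃ (λ m → f m (suc N)) n) (∑-L₃ f n N))
    (lemma (c₀ ⟨ + n ⟩) (c₁ ⟨ + n ⟩) (c₂ ⟨ + n ⟩) (c₃ ⟨ + n ⟩)
           (∑ (f n) N) (∑ (f (1 ℕ.+ n)) N) (∑ (f (2 ℕ.+ n)) N) (∑ (f (3 ℕ.+ n)) N)
           (f n (suc N)) (f (1 ℕ.+ n) (suc N)) (f (2 ℕ.+ n) (suc N)) (f (3 ℕ.+ n) (suc N)))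
    where lemma : ∀ a b c d x y z u x′ y′ z′ u′ → a * x + b * y + c * z + d * u + (a * x′ + b * y′ + c * z′ + d * u′)
                  ≡ a * (x + x′) + b * (y + y′) + c * (z + z′) + d * (u + u′)
          lemma = solve-∀

  ∑-pos : ∀ f N → ∑ (λ k → + f k) N ≡ + sumTo f N
  ∑-pos f zero    = refl
  ∑-pos f (suc N) = trans (cong (_+ + f (suc N)) (∑-pos f N)) (sym (pos-+ (sumTo f N) (f (suc N))))

  sumTo-term-extend : ∀ d n → sumTo (term n) (d ℕ.+ n) ≡ S n
  sumTo-term-extend zero    n = refl
  sumTo-term-extend (suc d) n rewrite k>n⇒nCk≡0 {n} {suc (d ℕ.+ n)} (s≤s (ℕ.m≤n+m n d)) =
    trans (ℕ.+-identityʳ (sumTo (term n) (d ℕ.+ n))) (sumTo-term-extend d n)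

  S≡∑F : ∀ d n → + S n ≡ ∑ (F n) (d ℕ.+ n)
  S≡∑F d n = trans (cong +_ (sym (sumTo-term-extend d n))) (sym (∑-pos (term n) (d ℕ.+ n)))

  G-end : ∀ n → G n (4 ℕ.+ n) - G n 0 ≡ 0ℤ
  G-end n = begin
    G n (4 ℕ.+ n) - G n 0                   ≡⟨ cong (λ x → x * B * B * W * s - 0ℤ) g[n,n+3]≡0 ⟩
    0ℤ * B * B * W * s - 0ℤ                 ≡⟨ lemma B W s ⟩
    0ℤ                                      ∎
    where
    B W s : ℤ
    B = + ((3 ℕ.+ n) C (3 ℕ.+ n))
    W = + ((2 ℕ.* (4 ℕ.+ n)) C (4 ℕ.+ n))
    s = + 2 * + (3 ℕ.+ n) + + 3
    g[n,n+3]≡0 : ⟦ g n̂ t̂ ⟧ (+ n ∷ + (3 ℕ.+ n) ∷ []) ≡ 0ℤ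
    g[n,n+3]≡0 = ≡-by-normalising (g n̂ (3 +̂ n̂)) (con 0ℤ) _ (+ n ∷ + 0 ∷ [])
    lemma : ∀ x y z → 0ℤ * x * x * y * z - 0ℤ ≡ 0ℤ
    lemma = solve-∀

  S-recurrence₃ : ∀ n → L₃ (λ m → + S m) n ≡ 0ℤ
  S-recurrence₃ n = begin
    L₃ (λ m → + S m) n
      ≡⟨ L₃-cong {λ m → + S m} {λ m → ∑ (F m) (3 ℕ.+ n)} n
                 (S≡∑F 3 n) (S≡∑F 2 (1 ℕ.+ n)) (S≡∑F 1 (2 ℕ.+ n)) (S≡∑F 0 (3 ℕ.+ n)) ⟩
    L₃ (λ m → ∑ (F m) (3 ℕ.+ n)) n          ≡⟨ ∑-L₃ F n (3 ℕ.+ n) ⟨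
    ∑ (λ k → L₃ (λ m → F m k) n) (3 ℕ.+ n)  ≡⟨ ∑-cong (3 ℕ.+ n) (telescoping-step n) ⟩
    ∑ (λ k → G n (suc k) - G n k) (3 ℕ.+ n) ≡⟨ ∑-telescope (G n) (3 ℕ.+ n) ⟩
    G n (4 ℕ.+ n) - G n 0                   ≡⟨ G-end n ⟩
    0ℤ                                      ∎

  p₀ p₁ p₂ : ∀ {k} → Expr k → Expr k
  p₀ n =   poly (693 ∷ 2034 ∷ 2133 ∷ 936 ∷ 144 ∷ []) n
  p₁ n = ⊝ poly (759 ∷ 2278 ∷ 2378 ∷ 1040 ∷ 160 ∷ []) n
  p₂ n =   poly (84 ∷ 244 ∷ 245 ∷ 104 ∷ 16 ∷ []) n

  L₂ : (ℕ → ℤ) → ℕ → ℤ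
  L₂ u n = p₀ ⟨ + n ⟩ * u n + p₁ ⟨ + n ⟩ * u (1 ℕ.+ n) + p₂ ⟨ + n ⟩ * u (2 ℕ.+ n)

  L₂ᵉ : ∀ {k} → Expr k → Expr k → Expr k → Expr k → Expr k
  L₂ᵉ n x₀ x₁ x₂ = p₀ n ⊗ x₀ ⊕ p₁ n ⊗ x₁ ⊕ p₂ n ⊗ x₂

  L₃ᵉ : ∀ {k} → Expr k → Expr k → Expr k → Expr k → Expr k → Expr k
  L₃ᵉ n x₀ x₁ x₂ x₃ = c₀ n ⊗ x₀ ⊕ c₁ n ⊗ x₁ ⊕ c₂ n ⊗ x₂ ⊕ c₃ n ⊗ x₃

  factorisation-lhs factorisation-rhs : Expr 5
  factorisation-lhs = p₂ (1 +̂ v₀) ⊗ p₀ v₀ ⊗ L₃ᵉ v₀ v₁ v₂ v₃ v₄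
  factorisation-rhs = c₃ v₀ ⊗ p₀ v₀ ⊗ L₂ᵉ (1 +̂ v₀) v₂ v₃ v₄ ⊕ c₀ v₀ ⊗ p₂ (1 +̂ v₀) ⊗ L₂ᵉ v₀ v₁ v₂ v₃

  L₃-factorisation : ∀ ρ → ⟦ factorisation-lhs ⟧ ρ ≡ ⟦ factorisation-rhs ⟧ ρ
  L₃-factorisation = ≡-by-normalising factorisation-lhs factorisation-rhs _

  S-recurrence₂ : ∀ n → L₂ (λ m → + S m) n ≡ 0ℤ
  S-recurrence₂ zero    = refl
  S-recurrence₂ (suc n) = *-cancelˡ-≡ U _ _ {{>-nonZero U>0}} (begin
    U * L₂ s (1 ℕ.+ n)              ≡⟨ +-identityʳ (U * L₂ s (1 ℕ.+ n)) ⟨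
    U * L₂ s (1 ℕ.+ n) + 0ℤ         ≡⟨ cong (_+_ (U * L₂ s (1 ℕ.+ n))) V*L₂≡0 ⟨
    U * L₂ s (1 ℕ.+ n) + V * L₂ s n ≡⟨ L₃-factorisation ρ ⟨
    K * L₃ s n                      ≡⟨ cong (K *_) (S-recurrence₃ n) ⟩
    K * 0ℤ                          ≡⟨ trans (*-zeroʳ K) (sym (*-zeroʳ U)) ⟩
    U * 0ℤ                          ∎)
    where
    s : ℕ → ℤ
    s m = + S m
    ρ : Vec ℤ 5
    ρ = + n ∷ s n ∷ s (1 ℕ.+ n) ∷ s (2 ℕ.+ n) ∷ s (3 ℕ.+ n) ∷ []
    K U V : ℤ
    K = ⟦ p₂ (1 +̂ v₀) ⊗ p₀ v₀ ⟧ ρ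
    U = ⟦ c₃ v₀ ⊗ p₀ v₀ ⟧ ρ
    V = ⟦ c₀ v₀ ⊗ p₂ (1 +̂ v₀) ⟧ ρ
    U>0 : 0ℤ < U
    U>0 = 0<-by-normalising (c₃ v₀ ⊗ p₀ v₀) _ (+ n ∷ []) (+≤+ z≤n ∷ [])
    V*L₂≡0 : V * L₂ s n ≡ 0ℤ
    V*L₂≡0 = trans (cong (V *_) (S-recurrence₂ n)) (*-zeroʳ V)

  -- Indices are shifted to n = 8 + t: the certificates below have nonnegative coefficients as
  -- polynomials in t.
  lo-num lo-den hi-num hi-den : ∀ {k} → Expr k → Expr k
  lo-num n = poly (0 ∷ 36 ∷ 18 ∷ []) n
  lo-den n = poly (1 ∷ 4 ∷ 2 ∷ []) n
  hi-num n = poly (9 ∷ 108 ∷ 54 ∷ []) n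
  hi-den n = poly (4 ∷ 12 ∷ 6 ∷ []) n

  lower-gap upper-gap : ℕ → ℤ
  lower-gap n = lo-den ⟨ + n ⟩ * + S (1 ℕ.+ n) - lo-num ⟨ + n ⟩ * + S n
  upper-gap n = hi-num ⟨ + n ⟩ * + S n - hi-den ⟨ + n ⟩ * + S (1 ℕ.+ n)

  lower-certificate upper-certificate : ∀ {k} → Expr k → Expr k → Expr k → Expr k
  lower-certificate t s δ =
    (lo-den (9 +̂ t) ⊗ ⊝ p₁ (8 +̂ t) ⊗ lo-num (8 +̂ t) ⊖ lo-num (9 +̂ t) ⊗ p₂ (8 +̂ t) ⊗ lo-num (8 +̂ t)
      ⊖ lo-den (9 +̂ t) ⊗ p₀ (8 +̂ t) ⊗ lo-den (8 +̂ t)) ⊗ s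
    ⊕ lo-den (9 +̂ t) ⊗ p₀ (8 +̂ t) ⊗ δ
  upper-certificate t s δ =
    (hi-num (9 +̂ t) ⊗ p₂ (8 +̂ t) ⊗ hi-num (8 +̂ t) ⊕ hi-den (9 +̂ t) ⊗ p₀ (8 +̂ t) ⊗ hi-den (8 +̂ t)
      ⊖ hi-den (9 +̂ t) ⊗ ⊝ p₁ (8 +̂ t) ⊗ hi-num (8 +̂ t)) ⊗ s
    ⊕ hi-den (9 +̂ t) ⊗ p₀ (8 +̂ t) ⊗ δ

  module _ (t : ℕ) where
    private
      ρ : Vec ℤ 4
      ρ = + t ∷ + S (8 ℕ.+ t) ∷ + S (9 ℕ.+ t) ∷ + S (10 ℕ.+ t) ∷ []
      ρ≥0 : All (0ℤ ≤_) ρ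
      ρ≥0 = +≤+ z≤n ∷ +≤+ z≤n ∷ +≤+ z≤n ∷ +≤+ z≤n ∷ []
      n : Expr 4
      n = 8 +̂ v₀

    lower-gap-step : 0ℤ ≤ lower-gap (8 ℕ.+ t) → 0ℤ ≤ lower-gap (9 ℕ.+ t)
    lower-gap-step gap≥0 = 0≤-by-certificate (⟦ P ⟧ ρ) (⟦ R ⟧ ρ)
      (0<-by-normalising P _ ρ ρ≥0) (S-recurrence₂ (8 ℕ.+ t)) (≡-by-normalising lhs rhs _ ρ)
      (0≤-by-normalising (lower-certificate v₀ v₁ v₂) _ (+ t ∷ + S (9 ℕ.+ t) ∷ lower-gap (8 ℕ.+ t) ∷ [])
                         (+≤+ z≤n ∷ +≤+ z≤n ∷ gap≥0 ∷ []))
      where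
      P R lhs rhs : Expr 4
      P   = p₂ n ⊗ lo-num n
      R   = lo-num n ⊗ lo-den (1 +̂ n)
      lhs = P ⊗ (lo-den (1 +̂ n) ⊗ v₃ ⊖ lo-num (1 +̂ n) ⊗ v₂) ⊖ R ⊗ L₂ᵉ n v₁ v₂ v₃
      rhs = lower-certificate v₀ v₂ (lo-den n ⊗ v₂ ⊖ lo-num n ⊗ v₁)

    upper-gap-step : 0ℤ ≤ upper-gap (8 ℕ.+ t) → 0ℤ ≤ upper-gap (9 ℕ.+ t)
    upper-gap-step gap≥0 = 0≤-by-certificate (⟦ P ⟧ ρ) (⟦ R ⟧ ρ)
      (0<-by-normalising P _ ρ ρ≥0) (S-recurrence₂ (8 ℕ.+ t)) (≡-by-normalising lhs rhs _ ρ)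
      (0≤-by-normalising (upper-certificate v₀ v₁ v₂) _ (+ t ∷ + S (9 ℕ.+ t) ∷ upper-gap (8 ℕ.+ t) ∷ [])
                         (+≤+ z≤n ∷ +≤+ z≤n ∷ gap≥0 ∷ []))
      where
      P R lhs rhs : Expr 4
      P   = p₂ n ⊗ hi-num n
      R   = ⊝ (hi-num n ⊗ hi-den (1 +̂ n))
      lhs = P ⊗ (hi-num (1 +̂ n) ⊗ v₂ ⊖ hi-den (1 +̂ n) ⊗ v₃) ⊖ R ⊗ L₂ᵉ n v₁ v₂ v₃
      rhs = upper-certificate v₀ v₂ (hi-num n ⊗ v₁ ⊖ hi-den n ⊗ v₂)

  lower-gap-nonneg : ∀ t → 0ℤ ≤ lower-gap (8 ℕ.+ t)
  lower-gap-nonneg zero    = +≤+ z≤n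
  lower-gap-nonneg (suc t) = lower-gap-step t (lower-gap-nonneg t)

  upper-gap-nonneg : ∀ t → 0ℤ ≤ upper-gap (8 ℕ.+ t)
  upper-gap-nonneg zero    = +≤+ z≤n
  upper-gap-nonneg (suc t) = upper-gap-step t (upper-gap-nonneg t)

  -- B and C are Δ S(n) and Δ S(n + 1) written in terms of the gaps u = lower-gap n and v = upper-gap n,
  -- where n = 8 + t and Δ = hi-num n lo-den n - lo-num n hi-den n.
  turán-certificate : ∀ {k} → Expr k → Expr k → Expr k → Expr k
  turán-certificate {k} t u v =
    p₀ m ⊗ p₀ n ⊗ B ⁴ ⊕ p₂ n ⊗ ⊝ p₁ m ⊗ B ⊗ C ³ ⊖ p₀ m ⊗ ⊝ p₁ n ⊗ B ³ ⊗ C ⊖ p₂ n ⊗ p₂ m ⊗ C ⁴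
    where
    m n B C : Expr k
    m = 7 +̂ t
    n = 8 +̂ t
    B = hi-den n ⊗ u ⊕ lo-den n ⊗ v
    C = hi-num n ⊗ u ⊕ lo-num n ⊗ v

  turán-gap : ℕ → ℤ
  turán-gap m = + S (2 ℕ.+ m) * + S (2 ℕ.+ m) * + S (2 ℕ.+ m) * + S m
              - + S (1 ℕ.+ m) * + S (1 ℕ.+ m) * + S (1 ℕ.+ m) * + S (3 ℕ.+ m)

  turán-gap-nonneg-from-7 : ∀ t → 0ℤ ≤ turán-gap (7 ℕ.+ t)
  turán-gap-nonneg-from-7 t = 0≤-by-certificate (⟦ P ⟧ ρ) (⟦ Δ ⁴ ⟧ ρ)
    (0<-by-normalising P _ ρ ρ≥0) recurrences (≡-by-normalising lhs rhs _ ρ)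
    (0≤-by-normalising (turán-certificate v₀ v₁ v₂) _ (+ t ∷ lower-gap (8 ℕ.+ t) ∷ upper-gap (8 ℕ.+ t) ∷ [])
                       (+≤+ z≤n ∷ lower-gap-nonneg t ∷ upper-gap-nonneg t ∷ []))
    where
    ρ : Vec ℤ 5
    ρ = + t ∷ + S (7 ℕ.+ t) ∷ + S (8 ℕ.+ t) ∷ + S (9 ℕ.+ t) ∷ + S (10 ℕ.+ t) ∷ []
    ρ≥0 : All (0ℤ ≤_) ρ
    ρ≥0 = +≤+ z≤n ∷ +≤+ z≤n ∷ +≤+ z≤n ∷ +≤+ z≤n ∷ +≤+ z≤n ∷ []
    m n Δ P X Y lhs rhs : Expr 5
    m   = 7 +̂ v₀
    n   = 8 +̂ v₀
    Δ   = hi-num n ⊗ lo-den n ⊖ lo-num n ⊗ hi-den n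
    P   = Δ ⁴ ⊗ p₀ m ⊗ p₂ n
    X   = p₂ n ⊗ v₃ ³
    Y   = p₀ m ⊗ v₂ ³
    lhs = P ⊗ (v₃ ³ ⊗ v₁ ⊖ v₂ ³ ⊗ v₄) ⊖ Δ ⁴ ⊗ (X ⊗ L₂ᵉ m v₁ v₂ v₃ ⊖ Y ⊗ L₂ᵉ n v₂ v₃ v₄)
    rhs = turán-certificate v₀ (lo-den n ⊗ v₃ ⊖ lo-num n ⊗ v₂) (hi-num n ⊗ v₂ ⊖ hi-den n ⊗ v₃)
    recurrences : ⟦ X ⊗ L₂ᵉ m v₁ v₂ v₃ ⊖ Y ⊗ L₂ᵉ n v₂ v₃ v₄ ⟧ ρ ≡ 0ℤ
    recurrences = trans (cong₂ (λ x y → ⟦ X ⟧ ρ * x - ⟦ Y ⟧ ρ * y)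
                               (S-recurrence₂ (7 ℕ.+ t)) (S-recurrence₂ (8 ℕ.+ t)))
                        (lemma (⟦ X ⟧ ρ) (⟦ Y ⟧ ρ))
      where lemma : ∀ a b → a * 0ℤ - b * 0ℤ ≡ 0ℤ
            lemma = solve-∀

  turán-gap-nonneg : ∀ m → 0ℤ ≤ turán-gap m
  turán-gap-nonneg 0 = +≤+ z≤n
  turán-gap-nonneg 1 = +≤+ z≤n
  turán-gap-nonneg 2 = +≤+ z≤n
  turán-gap-nonneg 3 = +≤+ z≤n
  turán-gap-nonneg 4 = +≤+ z≤n
  turán-gap-nonneg 5 = +≤+ z≤n
  turán-gap-nonneg 6 = +≤+ z≤n
  turán-gap-nonneg (suc (suc (suc (suc (suc (suc (suc t))))))) = turán-gap-nonneg-from-7 t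

open import Data.Integer using (+_)
import Data.Integer as ℤ
open import Data.Integer.Properties using (pos-*; 0≤i-j⇒j≤i)
open import Data.Integer.Tactic.RingSolver using (solve-∀)
open import Data.Rational using (_/_; _≤_; _*_; toℚᵘ)
open import Data.Rational.Properties using (toℚᵘ-cancel-≤; toℚᵘ-homo-*; toℚᵘ-fromℚᵘ)
import Data.Rational.Unnormalised as ℚᵘ
import Data.Rational.Unnormalised.Properties as ℚᵘ

toℚᵘ-/ : ∀ i n .{{_ : NonZero n}} → toℚᵘ (i / n) ℚᵘ.≃ (i ℚᵘ./ n)
toℚᵘ-/ i (suc n) = toℚᵘ-fromℚᵘ (ℚᵘ.mkℚᵘ i n)

toℚᵘ-/*/ : ∀ i j m n .{{_ : NonZero m}} .{{_ : NonZero n}} →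
           toℚᵘ ((i / m) * (j / n)) ℚᵘ.≃ (i ℚᵘ./ m) ℚᵘ.* (j ℚᵘ./ n)
toℚᵘ-/*/ i j m n = ℚᵘ.≃-trans (toℚᵘ-homo-* (i / m) (j / n)) (ℚᵘ.*-cong (toℚᵘ-/ i m) (toℚᵘ-/ j n))

[b/a]*[d/c]≤[c/b]*[c/b] : ∀ a b c d .{{_ : NonZero a}} .{{_ : NonZero b}} .{{_ : NonZero c}} →
  + b ℤ.* + b ℤ.* + b ℤ.* + d ℤ.≤ + c ℤ.* + c ℤ.* + c ℤ.* + a →
  (+ b / a) * (+ d / c) ≤ (+ c / b) * (+ c / b)
[b/a]*[d/c]≤[c/b]*[c/b] a@(suc _) b@(suc _) c@(suc _) d b³d≤c³a =
  toℚᵘ-cancel-≤ (ℚᵘ.≤-respˡ-≃ (ℚᵘ.≃-sym (toℚᵘ-/*/ (+ b) (+ d) a c))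
                (ℚᵘ.≤-respʳ-≃ (ℚᵘ.≃-sym (toℚᵘ-/*/ (+ c) (+ c) b b)) (ℚᵘ.*≤* (subst₂ ℤ._≤_ lhs rhs b³d≤c³a))))
  where
  lhs : + b ℤ.* + b ℤ.* + b ℤ.* + d ≡ + b ℤ.* + d ℤ.* + (b ℕ.* b)
  lhs = trans (lemma (+ b) (+ d)) (cong (ℤ._*_ (+ b ℤ.* + d)) (sym (pos-* b b)))
    where lemma : ∀ x y → x ℤ.* x ℤ.* x ℤ.* y ≡ x ℤ.* y ℤ.* (x ℤ.* x)
          lemma = solve-∀
  rhs : + c ℤ.* + c ℤ.* + c ℤ.* + a ≡ + c ℤ.* + c ℤ.* + (a ℕ.* c)
  rhs = trans (lemma (+ c) (+ a)) (cong (ℤ._*_ (+ c ℤ.* + c)) (sym (pos-* a c)))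
    where lemma : ∀ x y → x ℤ.* x ℤ.* x ℤ.* y ≡ x ℤ.* x ℤ.* (y ℤ.* x)
          lemma = solve-∀

theorem4p8 : (m : ℕ) → ratio m * ratio (suc (suc m)) ≤ ratio (suc m) * ratio (suc m)
theorem4p8 m = [b/a]*[d/c]≤[c/b]*[c/b] (S m) (S (suc m)) (S (suc (suc m))) (S (suc (suc (suc m))))
  {{S-nonZero m}} {{S-nonZero (suc m)}} {{S-nonZero (suc (suc m))}}
  (0≤i-j⇒j≤i (turán-gap-nonneg m))
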